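{- Let $p$ be an odd prime, $m\ge1$, $q=p^m$, and let $\gamma\in GF(q^2)$ with $\gamma^2\ne\bar\gamma^2$. Let $B^1_{(c_1,r_1)}$ and $B^1_{(c_2,r_2)}$ be two distinct circles of the first type in $\mathbb M(q)$, each tangent to both $B^2_{(\gamma,0)}$ and $B^2_{(\bar\gamma,0)}$, with $c_1=-\bar c_1$ and $c_2=-\bar c_2$. Then $B^1_{(c_1,r_1)}$ and $B^1_{(c_2,r_2)}$ are tangent if and only if $-\gamma\bar\gamma$ is a nonsquare in $GF(q)$ and \[ c_2=c_1\cdot\frac{2\sqrt{ -\gamma\bar\gamma}\pm(\gamma-\bar\gamma)}{2\sqrt{ -\gamma\bar\gamma}\mp(\gamma-\bar\gamma)} \] for one of the two choices of sign, where $\sqrt{ -\gamma\bar\gamma}$ is a square root of $-\gamma\bar\gamma$ in $GF(q^2)$.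
   Context: $GF(q^2)$ is the quadratic extension of $GF(q)$ and $\bar z:=z^q$. The plane $\mathbb M(q)$ has point set $GF(q^2)\cup\{\infty\}$; its circles are $B^1_{(c,r)}=\{z\in GF(q^2):(z-c)(\bar z-\bar c)=r\}$ ($c\in GF(q^2)$, $r\in GF(q)\setminus\{0\}$; first type) and $B^2_{(c,r)}=\{z\in GF(q^2):\bar c z+c\bar z=r\}\cup\{\infty\}$ ($c\in GF(q^2)\setminus\{0\}$, $r\in GF(q)$; second type). Two distinct circles are tangent if they have exactly one common point. -}

module Defs where

open import Level using (0ℓ)
open import Data.Nat using (ℕ; zero; suc)
open import Data.Fin using (Fin)
open import Data.Maybe using (Maybe; just; nothing)
open import Data.Product using (Σ; ∃; _×_; _,_)
open import Data.Unit using (⊤)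
open import Data.Empty using (⊥)
open import Relation.Nullary using (¬_)
open import Relation.Binary.PropositionalEquality using (_≡_)
open import Algebra.Structures using (IsCommutativeRing)
open import Function.Bundles using (_↔_; _⇔_)

-- A field (with propositional equality).  The inverse is total with the
-- convention that 0⁻¹ is arbitrary; only x ≢ 0 → x * x⁻¹ ≡ 1 is required.
record Field : Set₁ where
  infixl 7 _*_
  infixl 6 _+_ _-_
  infix  8 -_ _⁻¹
  field
    Carrier : Set
    _+_ _*_ : Carrier → Carrier → Carrier
    -_ _⁻¹  : Carrier → Carrier
    0# 1#   : Carrier
    isCommutativeRing : IsCommutativeRing _≡_ _+_ _*_ -_ 0# 1#
    0≢1     : ¬ (0# ≡ 1#)
    inverse : ∀ x → ¬ (x ≡ 0#) → x * (x ⁻¹) ≡ 1#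

  _-_ : Carrier → Carrier → Carrier
  x - y = x + (- y)

  _/_ : Carrier → Carrier → Carrier
  x / y = x * (y ⁻¹)

  _^_ : Carrier → ℕ → Carrier
  x ^ zero  = 1#
  x ^ suc n = x * (x ^ n)

  2# : Carrier
  2# = 1# + 1#

record FiniteField (n : ℕ) : Set₁ where
  field
    field′ : Field
    card   : Field.Carrier field′ ↔ Fin n
  open Field field′ public

-- The plane M(q), built over a field K of order q² (K ≅ GF(q²)).
module Plane {n : ℕ} (q : ℕ) (K : FiniteField n) where
  open FiniteField K

  conj : Carrier → Carrier
  conj z = z ^ q

  InGFq : Carrier → Set
  InGFq x = conj x ≡ x

  -- points: GF(q²) ∪ {∞}, with nothing = ∞
  Point : Set
  Point = Maybe Carrier

  B1 : Carrier → Carrier → Point → Set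
  B1 c r nothing  = ⊥
  B1 c r (just z) = (z - c) * (conj z - conj c) ≡ r

  B2 : Carrier → Carrier → Point → Set
  B2 c r nothing  = ⊤
  B2 c r (just z) = conj c * z + c * conj z ≡ r

  ValidB1 : Carrier → Carrier → Set
  ValidB1 c r = InGFq r × ¬ (r ≡ 0#)

  ValidB2 : Carrier → Carrier → Set
  ValidB2 c r = ¬ (c ≡ 0#) × InGFq r

  Distinct : (Point → Set) → (Point → Set) → Set
  Distinct A B = ¬ (∀ P → (A P ⇔ B P))

  Tangent : (Point → Set) → (Point → Set) → Set
  Tangent A B = Distinct A B ×
    Σ Point (λ P → (A P × B P) × (∀ Q → A Q → B Q → Q ≡ P))

  IsSquareInGFq : Carrier → Set
  IsSquareInGFq x = Σ Carrier (λ y → InGFq y × (y * y ≡ x))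

-- Conjugation z ↦ z^q is an involutive automorphism of GF(q²) (binomial theorem in characteristic p,
-- and Fermat's little theorem for a field with q² elements), and once the centres are anti-fixed,
-- c̄ = −c, all remaining steps are polynomial identities. A circle centred at c meets the line
-- B²(γ,0) in two points exchanged by a reflection, so tangency forces 4γγ̄r = (c(γ − γ̄))².
-- Two such circles meet only on the radical line z̄ = z − 2h, where 8γγ̄h = (c₁ + c₂)(γ + γ̄)²,
-- in a pair of points symmetric about h; they are tangent iff h itself lies on both, i.e. iff
-- Δ = (δ(c₁ + c₂))² + 4γγ̄(c₁ − c₂)² vanishes, δ = γ − γ̄. For s² = −γγ̄, Δ is the product of
-- c₁(2s + δ) − c₂(2s − δ) and c₂(2s + δ) − c₁(2s − δ), which yields the two ratios. If −γγ̄ had a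
-- square root in GF(q), conjugation would swap the two factors for that root, so both would vanish
-- and force c₁ = c₂.

module Submission where

open import Defs
open import Algebra.Bundles using (CommutativeRing; CommutativeMonoid)
open import Algebra.Structures using (IsCommutativeRing)
open import Data.Empty using (⊥-elim)
open import Data.Fin.Base as Fin using (Fin)
import Data.Fin.Properties as Fin
open import Data.Fin.Permutation using (Permutation; permutation)
open import Data.Maybe.Base using (Maybe; just; nothing)
import Data.Maybe.Properties as Maybe
open import Data.Nat.Base as ℕ using (ℕ; zero; suc; _∸_; _!)
import Data.Nat.Properties as ℕ
open import Data.Nat.Primality using (Prime)
open import Data.Product.Base using (∃; _×_; _,_)
open import Data.Sign.Base as Sign using (Sign)
open import Data.Sum.Base as Sum using (_⊎_; inj₁; inj₂)
open import Data.Sum.Function.Propositional using (_⊎-⇔_)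
open import Function.Base using (_∘_; id)
open import Function.Bundles using (_↔_; _⇔_; mk⇔; Inverse; Equivalence)
import Function.Properties.Equivalence as ⇔
open import Function.Properties.Inverse using (↔⇒↣)
open import Level using (0ℓ)
open import Relation.Binary.PropositionalEquality as ≡ using (_≡_; _≢_)
open import Relation.Nullary using (¬_; Dec; yes; no)
open import Relation.Nullary.Decidable using (via-injection)

-- The reflective solver of the standard library takes its coefficients from the carrier and cannot
-- see that 1# + - 1# vanishes in an abstract ring; Algebra.Solver.Ring is instantiated here with
-- integer coefficients through the canonical map ℤ → R instead.
module IntegerCoefficients {c ℓ} (R : CommutativeRing c ℓ) where
  open CommutativeRing R
  open import Data.Integer.Base as ℤ using (ℤ; +_; -[1+_]; _⊖_; _◃_; sign; ∣_∣)
  import Data.Integer.Properties as ℤ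
  open import Algebra.Properties.Ring ring using (-‿involutive; -0#≈0#; -‿distribˡ-*; -‿distribʳ-*)
  open import Algebra.Properties.AbelianGroup +-abelianGroup using (⁻¹-∙-comm)
  open import Algebra.Properties.CommutativeSemigroup +-commutativeSemigroup using (interchange)
  open import Algebra.Properties.Semiring.Mult.TCOptimised semiring renaming (_×_ to _×′_) using (1+×; ×-homo-+; ×1-homo-*)
  open import Algebra.Solver.Ring.AlmostCommutativeRing using (fromCommutativeRing; _-Raw-AlmostCommutative⟶_)
  open import Relation.Binary.Reasoning.Setoid setoid

  signed : Sign → Carrier → Carrier
  signed Sign.+ x = x
  signed Sign.- x = - x

  -- The optimised multiple _×′_ makes ⟦ + 2 ⟧ℤ reduce to 1# + 1#, which is 2# by definition.
  ⟦_⟧ℤ : ℤ → Carrier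
  ⟦ + n ⟧ℤ      = n ×′ 1#
  ⟦ -[1+ n ] ⟧ℤ = - (suc n ×′ 1#)

  ⟦◃⟧ : ∀ s n → ⟦ s ◃ n ⟧ℤ ≈ signed s (n ×′ 1#)
  ⟦◃⟧ Sign.+ zero    = refl
  ⟦◃⟧ Sign.- zero    = sym -0#≈0#
  ⟦◃⟧ Sign.+ (suc n) = refl
  ⟦◃⟧ Sign.- (suc n) = refl

  signed-cong : ∀ s {x y} → x ≈ y → signed s x ≈ signed s y
  signed-cong Sign.+ x≈y = x≈y
  signed-cong Sign.- x≈y = -‿cong x≈y

  signed-* : ∀ s t x y → signed (s Sign.* t) (x * y) ≈ signed s x * signed t y
  signed-* Sign.+ Sign.+ x y = refl
  signed-* Sign.+ Sign.- x y = -‿distribʳ-* x y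
  signed-* Sign.- Sign.+ x y = -‿distribˡ-* x y
  signed-* Sign.- Sign.- x y = begin
    x * y         ≈⟨ -‿involutive (x * y) ⟨
    - - (x * y)   ≈⟨ -‿cong (-‿distribʳ-* x y) ⟩
    - (x * - y)   ≈⟨ -‿distribˡ-* x (- y) ⟩
    - x * - y     ∎

  ⟦⊖⟧ : ∀ m n → ⟦ m ⊖ n ⟧ℤ ≈ m ×′ 1# - n ×′ 1#
  ⟦⊖⟧ m       zero    = begin
    m ×′ 1#          ≈⟨ +-identityʳ (m ×′ 1#) ⟨
    m ×′ 1# + 0#     ≈⟨ +-congˡ -0#≈0# ⟨
    m ×′ 1# - 0#     ∎
  ⟦⊖⟧ zero    (suc n) = sym (+-identityˡ _)
  ⟦⊖⟧ (suc m) (suc n) = begin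
    ⟦ suc m ⊖ suc n ⟧ℤ       ≡⟨ ≡.cong ⟦_⟧ℤ (ℤ.[1+m]⊖[1+n]≡m⊖n m n) ⟩
    ⟦ m ⊖ n ⟧ℤ               ≈⟨ ⟦⊖⟧ m n ⟩
    a - b                    ≈⟨ +-identityˡ (a - b) ⟨
    0# + (a - b)             ≈⟨ +-congʳ (-‿inverseʳ 1#) ⟨
    (1# - 1#) + (a - b)      ≈⟨ interchange 1# (- 1#) a (- b) ⟩
    (1# + a) + (- 1# - b)    ≈⟨ +-congˡ (⁻¹-∙-comm 1# b) ⟩
    (1# + a) - (1# + b)      ≈⟨ +-cong (1+× m 1#) (-‿cong (1+× n 1#)) ⟨
    suc m ×′ 1# - suc n ×′ 1#  ∎
    where
    a b : Carrier
    a = m ×′ 1#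
    b = n ×′ 1#

  ⟦⟧-+ : ∀ i j → ⟦ i ℤ.+ j ⟧ℤ ≈ ⟦ i ⟧ℤ + ⟦ j ⟧ℤ
  ⟦⟧-+ (+ m)    (+ n)    = ×-homo-+ 1# m n
  ⟦⟧-+ (+ m)    -[1+ n ] = ⟦⊖⟧ m (suc n)
  ⟦⟧-+ -[1+ m ] (+ n)    = trans (⟦⊖⟧ n (suc m)) (+-comm _ _)
  ⟦⟧-+ -[1+ m ] -[1+ n ] = begin
    - (suc (suc (m ℕ.+ n)) ×′ 1#)  ≡⟨ ≡.cong (λ k → - (suc k ×′ 1#)) (ℕ.+-suc m n) ⟨
    - ((suc m ℕ.+ suc n) ×′ 1#)    ≈⟨ -‿cong (×-homo-+ 1# (suc m) (suc n)) ⟩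
    - (suc m ×′ 1# + suc n ×′ 1#)   ≈⟨ ⁻¹-∙-comm _ _ ⟨
    - (suc m ×′ 1#) - suc n ×′ 1#   ∎

  ⟦⟧-neg : ∀ i → ⟦ ℤ.- i ⟧ℤ ≈ - ⟦ i ⟧ℤ
  ⟦⟧-neg (+ zero)  = sym -0#≈0#
  ⟦⟧-neg (+ suc n) = refl
  ⟦⟧-neg -[1+ n ]  = sym (-‿involutive _)

  ⟦⟧-* : ∀ i j → ⟦ i ℤ.* j ⟧ℤ ≈ ⟦ i ⟧ℤ * ⟦ j ⟧ℤ
  ⟦⟧-* i j = begin
    ⟦ s ◃ ∣ i ∣ ℕ.* ∣ j ∣ ⟧ℤ                                     ≈⟨ ⟦◃⟧ s (∣ i ∣ ℕ.* ∣ j ∣) ⟩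
    signed s ((∣ i ∣ ℕ.* ∣ j ∣) ×′ 1#)                          ≈⟨ signed-cong s (×1-homo-* ∣ i ∣ ∣ j ∣) ⟩
    signed s (∣ i ∣ ×′ 1# * ∣ j ∣ ×′ 1#)                         ≈⟨ signed-* (sign i) (sign j) _ _ ⟩
    signed (sign i) (∣ i ∣ ×′ 1#) * signed (sign j) (∣ j ∣ ×′ 1#) ≈⟨ *-cong (sign◃abs i) (sign◃abs j) ⟩
    ⟦ i ⟧ℤ * ⟦ j ⟧ℤ                                            ∎
    where
    s : Sign
    s = sign i Sign.* sign j
    sign◃abs : ∀ i → signed (sign i) (∣ i ∣ ×′ 1#) ≈ ⟦ i ⟧ℤ
    sign◃abs i = trans (sym (⟦◃⟧ (sign i) ∣ i ∣)) (reflexive (≡.cong ⟦_⟧ℤ (ℤ.◃-inverse i)))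

  ℤ-morphism : ℤ.+-*-rawRing -Raw-AlmostCommutative⟶ fromCommutativeRing R
  ℤ-morphism = record
    { ⟦_⟧ = ⟦_⟧ℤ ; +-homo = ⟦⟧-+ ; *-homo = ⟦⟧-* ; -‿homo = ⟦⟧-neg ; 0-homo = refl ; 1-homo = refl }

  _≟ℤ_ : ∀ i j → Maybe (⟦ i ⟧ℤ ≈ ⟦ j ⟧ℤ)
  i ≟ℤ j with i ℤ.≟ j
  ... | yes ≡.refl = just refl
  ... | no _     = nothing

  open import Algebra.Solver.Ring ℤ.+-*-rawRing (fromCommutativeRing R) ℤ-morphism _≟ℤ_ public

  num : ∀ {k} → ℕ → Polynomial k
  num n = con (+ n)

module PrimeProperties where
  open import Data.Nat.Combinatorics using (_C_; nCk≡n!/k![n-k]!; k![n∸k]!∣n!)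
  open import Data.Nat.DivMod using (_%_; _/_; m/n*n≡m; m≡m%n+[m/n]*n; m%n<n)
  open import Data.Nat.Divisibility using (_∣_; divides; m∣m*n; ∣⇒≤; ∣1⇒≡1)
  open import Data.Nat.Primality using (euclidsLemma; prime⇒nonTrivial; prime⇒irreducible)

  prime∤! : ∀ {p j} → Prime p → j ℕ.< p → ¬ p ∣ j !
  prime∤! {p} {zero}  p-prime _   p∣1  = ℕ.<⇒≢ (ℕ.nonTrivial⇒n>1 p {{prime⇒nonTrivial p-prime}}) (≡.sym (∣1⇒≡1 p∣1))
  prime∤! {p} {suc j} p-prime j<p p∣j! with euclidsLemma (suc j) (j !) p-prime p∣j!
  ... | inj₁ p∣1+j = ℕ.<⇒≱ j<p (∣⇒≤ p∣1+j)
  ... | inj₂ p∣j!  = prime∤! p-prime (ℕ.<-trans (ℕ.n<1+n j) j<p) p∣j!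

  prime∣choose : ∀ {p k} → Prime p → 0 ℕ.< k → k ℕ.< p → p ∣ p C k
  prime∣choose {p@(suc p-1)} {k} p-prime 0<k k<p
    with euclidsLemma (p C k) (k ! ℕ.* (p ∸ k) !) p-prime p∣pCk*k![p-k]!
    where
    p∣pCk*k![p-k]! : p ∣ (p C k) ℕ.* (k ! ℕ.* (p ∸ k) !)
    p∣pCk*k![p-k]! = ≡.subst (p ∣_) p!≡pCk*k![p-k]! (m∣m*n (p-1 !))
      where
      instance
        k!*[p-k]!≢0 : ℕ.NonZero (k ! ℕ.* (p ∸ k) !)
        k!*[p-k]!≢0 = ℕ._!*_!≢0 k (p ∸ k)
      p!≡pCk*k![p-k]! : p ! ≡ (p C k) ℕ.* (k ! ℕ.* (p ∸ k) !)
      p!≡pCk*k![p-k]! = ≡.trans (≡.sym (m/n*n≡m (k![n∸k]!∣n! (ℕ.<⇒≤ k<p))))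
                                (≡.cong (ℕ._* (k ! ℕ.* (p ∸ k) !)) (≡.sym (nCk≡n!/k![n-k]! (ℕ.<⇒≤ k<p))))
  ... | inj₁ p∣pCk = p∣pCk
  ... | inj₂ p∣k![p-k]! with euclidsLemma (k !) ((p ∸ k) !) p-prime p∣k![p-k]!
  ...   | inj₁ p∣k!     = ⊥-elim (prime∤! p-prime k<p p∣k!)
  ...   | inj₂ p∣[p-k]! = ⊥-elim (prime∤! p-prime (ℕ.∸-monoʳ-< 0<k (ℕ.<⇒≤ k<p)) p∣[p-k]!)

  odd-prime : ∀ {p} → Prime p → p ≢ 2 → ∃ λ k → p ≡ suc (k ℕ.* 2)
  odd-prime {p} p-prime p≢2 with p % 2 | m≡m%n+[m/n]*n p 2 | m%n<n p 2
  ... | 0           | p≡[p/2]*2 | _ with prime⇒irreducible p-prime (divides (p / 2) p≡[p/2]*2)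
  ...   | inj₂ 2≡p = ⊥-elim (p≢2 (≡.sym 2≡p))
  odd-prime {p} p-prime p≢2 | 1 | p≡1+[p/2]*2 | _ = p / 2 , p≡1+[p/2]*2
  odd-prime {p} p-prime p≢2 | suc (suc _) | _ | ℕ.s≤s (ℕ.s≤s ())

module FieldProperties (F : Field) where
  open Field F
  open IsCommutativeRing isCommutativeRing public
    using (+-comm; *-assoc; *-comm; +-identityˡ; +-identityʳ; *-identityˡ; *-identityʳ; -‿inverseʳ; zeroˡ; zeroʳ)
  open ≡ using (refl; sym; trans; cong; cong₂; module ≡-Reasoning)

  commutativeRing : CommutativeRing 0ℓ 0ℓ
  commutativeRing = record { isCommutativeRing = isCommutativeRing }

  open CommutativeRing commutativeRing public using (ring; semiring; +-group; +-commutativeMonoid; *-commutativeMonoid)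
  open IntegerCoefficients commutativeRing public using (solve; _:=_; num; _:+_; _:*_; _:-_; :-_)
  open import Algebra.Properties.Ring ring public using (-‿involutive; -0#≈0#)
  open import Algebra.Properties.Group +-group public using (x∙y⁻¹≈ε⇒x≈y; identityˡ-unique; inverseʳ-unique)

  x-y≡0⇒x≡y : ∀ {x y} → x - y ≡ 0# → x ≡ y
  x-y≡0⇒x≡y = x∙y⁻¹≈ε⇒x≈y _ _

  x≡y⇒x-y≡0 : ∀ {x y} → x ≡ y → x - y ≡ 0#
  x≡y⇒x-y≡0 {x} refl = -‿inverseʳ x

  x-y≡0⇔x≡y : ∀ {x y} → (x - y ≡ 0# ⇔ x ≡ y)
  x-y≡0⇔x≡y = mk⇔ x-y≡0⇒x≡y x≡y⇒x-y≡0

  -x≡0⇒x≡0 : ∀ {x} → - x ≡ 0# → x ≡ 0#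
  -x≡0⇒x≡0 {x} -x≡0 = trans (sym (-‿involutive x)) (trans (cong -_ -x≡0) -0#≈0#)

  -x*-y≡x*y : ∀ x y → - x * - y ≡ x * y
  -x*-y≡x*y = solve 2 (λ x y → :- x :* :- y := x :* y) refl

  x⁻¹*x≡1 : ∀ {x} → x ≢ 0# → x ⁻¹ * x ≡ 1#
  x⁻¹*x≡1 {x} x≢0 = trans (*-comm (x ⁻¹) x) (inverse x x≢0)

  *-cancelˡ : ∀ {k x y} → k ≢ 0# → k * x ≡ k * y → x ≡ y
  *-cancelˡ {k} {x} {y} k≢0 kx≡ky = begin
    x                ≡⟨ sym (*-identityˡ x) ⟩
    1# * x           ≡⟨ cong (_* x) (sym (x⁻¹*x≡1 k≢0)) ⟩
    k ⁻¹ * k * x     ≡⟨ *-assoc (k ⁻¹) k x ⟩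
    k ⁻¹ * (k * x)   ≡⟨ cong (k ⁻¹ *_) kx≡ky ⟩
    k ⁻¹ * (k * y)   ≡⟨ *-assoc (k ⁻¹) k y ⟨
    k ⁻¹ * k * y     ≡⟨ cong (_* y) (x⁻¹*x≡1 k≢0) ⟩
    1# * y           ≡⟨ *-identityˡ y ⟩
    y                ∎
    where open ≡-Reasoning

  x≢0∧x*y≡0⇒y≡0 : ∀ {x y} → x ≢ 0# → x * y ≡ 0# → y ≡ 0#
  x≢0∧x*y≡0⇒y≡0 {x} x≢0 xy≡0 = *-cancelˡ x≢0 (trans xy≡0 (sym (zeroʳ x)))

  *-≢0 : ∀ {x y} → x ≢ 0# → y ≢ 0# → x * y ≢ 0#
  *-≢0 x≢0 y≢0 = y≢0 ∘ x≢0∧x*y≡0⇒y≡0 x≢0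

  x*y≡1⇒y≡x⁻¹ : ∀ {x y} → x * y ≡ 1# → y ≡ x ⁻¹
  x*y≡1⇒y≡x⁻¹ {x} {y} xy≡1 = *-cancelˡ x≢0 (trans xy≡1 (sym (inverse x x≢0)))
    where
    x≢0 : x ≢ 0#
    x≢0 x≡0 = 0≢1 (trans (sym (zeroˡ y)) (trans (cong (_* y) (sym x≡0)) xy≡1))

  x-y≡z⇔x≡z+y : ∀ {x y z} → (x - y ≡ z ⇔ x ≡ z + y)
  x-y≡z⇔x≡z+y {x} {y} {z} = mk⇔
    (λ x-y≡z → trans (solve 2 (λ x y → x := x :- y :+ y) refl x y) (cong (_+ y) x-y≡z))
    (λ x≡z+y → trans (cong (_- y) x≡z+y) (solve 2 (λ z y → z :+ y :- y := z) refl z y))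

  *-≡0⇔ : ∀ {a b x y} → a ≢ 0# → b ≢ 0# → a * x ≡ b * y → (x ≡ 0# ⇔ y ≡ 0#)
  *-≡0⇔ {a} {b} {x} {y} a≢0 b≢0 ax≡by = mk⇔
    (λ x≡0 → x≢0∧x*y≡0⇒y≡0 b≢0 (trans (sym ax≡by) (trans (cong (a *_) x≡0) (zeroʳ a))))
    (λ y≡0 → x≢0∧x*y≡0⇒y≡0 a≢0 (trans ax≡by (trans (cong (b *_) y≡0) (zeroʳ b))))

  *-/-≡⇔ : ∀ {x y n d} → d ≢ 0# → (x ≡ y * (n / d) ⇔ x * d ≡ y * n)
  *-/-≡⇔ {x} {y} {n} {d} d≢0 = mk⇔
    (λ x≡y*n/d → trans (cong (_* d) x≡y*n/d) (trans (*-assoc y (n / d) d)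
                   (cong (y *_) (trans (*-assoc n (d ⁻¹) d) (trans (cong (n *_) (x⁻¹*x≡1 d≢0)) (*-identityʳ n))))))
    (λ x*d≡y*n → *-cancelˡ d≢0 (trans (*-comm d x) (trans x*d≡y*n (sym (d*[y*[n/d]]≡y*n)))))
    where
    d*[y*[n/d]]≡y*n : d * (y * (n / d)) ≡ y * n
    d*[y*[n/d]]≡y*n = trans (solve 4 (λ d y n i → d :* (y :* (n :* i)) := y :* n :* (d :* i)) refl d y n (d ⁻¹))
                            (trans (cong (y * n *_) (inverse d d≢0)) (*-identityʳ (y * n)))

  import Algebra.Properties.CommutativeSemiring.Exp (CommutativeRing.commutativeSemiring commutativeRing) as Exp

  ^≡Exp^ : ∀ x n → x ^ n ≡ x Exp.^ n
  ^≡Exp^ x zero    = refl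
  ^≡Exp^ x (suc n) = cong (x *_) (^≡Exp^ x n)

  ^-distrib-* : ∀ x y n → (x * y) ^ n ≡ x ^ n * y ^ n
  ^-distrib-* x y n = trans (^≡Exp^ (x * y) n)
    (trans (Exp.^-distrib-* x y n) (sym (cong₂ _*_ (^≡Exp^ x n) (^≡Exp^ y n))))

  ^-*-assoc : ∀ x m n → (x ^ m) ^ n ≡ x ^ (m ℕ.* n)
  ^-*-assoc x m n = trans (^≡Exp^ (x ^ m) n)
    (trans (cong (Exp._^ n) (^≡Exp^ x m)) (trans (Exp.^-assocʳ x m n) (sym (^≡Exp^ x (m ℕ.* n)))))

  open import Algebra.Properties.Semiring.Mult semiring public using (×-assoc-*; ×1-homo-*) renaming (_×_ to _·_)

  1^n≡1 : ∀ n → 1# ^ n ≡ 1#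
  1^n≡1 zero    = refl
  1^n≡1 (suc n) = trans (*-identityˡ _) (1^n≡1 n)

  2#≡0⇒[1+2k]·1≡1 : 2# ≡ 0# → ∀ k → suc (k ℕ.* 2) · 1# ≡ 1#
  2#≡0⇒[1+2k]·1≡1 2≡0 k = begin
    1# + (k ℕ.* 2) · 1#               ≡⟨ cong (1# +_) (×1-homo-* k 2) ⟩
    1# + k · 1# * (1# + (1# + 0#))    ≡⟨ cong (λ t → 1# + k · 1# * (1# + t)) (+-identityʳ 1#) ⟩
    1# + k · 1# * 2#                  ≡⟨ cong (λ t → 1# + k · 1# * t) 2≡0 ⟩
    1# + k · 1# * 0#                  ≡⟨ cong (1# +_) (zeroʳ (k · 1#)) ⟩
    1# + 0#                           ≡⟨ +-identityʳ 1# ⟩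
    1#                                ∎
    where open ≡-Reasoning

module FiniteFieldProperties (F : Field) {n} (card : Field.Carrier F ↔ Fin n) where
  open Field F
  open FieldProperties F
  open ≡ using (refl; sym; trans; cong; cong₂; module ≡-Reasoning)
  open Inverse card using (to; from; strictlyInverseˡ; strictlyInverseʳ)

  _≟_ : (x y : Carrier) → Dec (x ≡ y)
  _≟_ = via-injection (↔⇒↣ card) Fin._≟_

  x*y≡0⇒x≡0⊎y≡0 : ∀ {x y} → x * y ≡ 0# → x ≡ 0# ⊎ y ≡ 0#
  x*y≡0⇒x≡0⊎y≡0 {x} {y} xy≡0 with x ≟ 0# | y ≟ 0#
  ... | yes x≡0 | _       = inj₁ x≡0
  ... | no _    | yes y≡0 = inj₂ y≡0
  ... | no x≢0  | no y≢0  = ⊥-elim (*-≢0 x≢0 y≢0 xy≡0)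

  x*y≡0⇔x≡0⊎y≡0 : ∀ {x y} → (x * y ≡ 0# ⇔ (x ≡ 0# ⊎ y ≡ 0#))
  x*y≡0⇔x≡0⊎y≡0 {x} {y} = mk⇔ x*y≡0⇒x≡0⊎y≡0 λ
    { (inj₁ refl) → zeroˡ y
    ; (inj₂ refl) → zeroʳ x
    }

  module ElementSum (M : CommutativeMonoid 0ℓ 0ℓ) where
    open CommutativeMonoid M using (_≈_; ε) renaming (Carrier to A; sym to ≈-sym; trans to ≈-trans; reflexive to ≈-reflexive)
    open import Algebra.Properties.CommutativeMonoid.Sum M public
      using (sum; sum-permute; sum-remove; sum-cong-≗; sum-cong-≋; sum-replicate; sum-replicate-zero; ∑-distrib-+)

    ∑ᴷ : (Carrier → A) → A
    ∑ᴷ φ = sum (φ ∘ from)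

    ∑ᴷ-reindex : ∀ (f g : Carrier → Carrier) → (∀ x → f (g x) ≡ x) → (∀ x → g (f x) ≡ x) →
                 ∀ φ → ∑ᴷ (φ ∘ f) ≈ ∑ᴷ φ
    ∑ᴷ-reindex f g f∘g≗id g∘f≗id φ = ≈-sym (≈-trans (sum-permute (φ ∘ from) π)
      (≈-reflexive (sum-cong-≗ (λ i → cong φ (strictlyInverseʳ (f (from i)))))))
      where
      π : Permutation n n
      π = permutation (to ∘ f ∘ from) (to ∘ g ∘ from)
        (λ i → trans (cong (to ∘ f) (strictlyInverseʳ (g (from i)))) (trans (cong to (f∘g≗id (from i))) (strictlyInverseˡ i)))
        (λ i → trans (cong (to ∘ g) (strictlyInverseʳ (f (from i)))) (trans (cong to (g∘f≗id (from i))) (strictlyInverseˡ i)))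

    ∑ᴷ-single : ∀ φ a → (∀ y → y ≢ a → φ y ≈ ε) → ∑ᴷ φ ≈ φ a
    ∑ᴷ-single φ a φ≈ε = ≈-trans (sum-single (φ ∘ from) (to a) φ∘from≈ε) (≈-reflexive (cong φ (strictlyInverseʳ a)))
      where
      open CommutativeMonoid M using (∙-congˡ; identityʳ)
      φ∘from≈ε : ∀ j → j ≢ to a → φ (from j) ≈ ε
      φ∘from≈ε j j≢to-a = φ≈ε (from j) (λ from-j≡a → j≢to-a (trans (sym (strictlyInverseˡ j)) (cong to from-j≡a)))
      sum-single : ∀ {k} (t : Fin k → A) i → (∀ j → j ≢ i → t j ≈ ε) → sum t ≈ t i
      sum-single {suc k} t i t≈ε = ≈-trans (sum-remove {i = i} t) (≈-trans
        (∙-congˡ (≈-trans (sum-cong-≋ (λ j → t≈ε (Fin.punchIn i j) (Fin.punchInᵢ≢i i j))) (sum-replicate-zero k)))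
        (identityʳ (t i)))

  module ∑ = ElementSum +-commutativeMonoid
  module ∏ = ElementSum *-commutativeMonoid

  card·x≡0 : ∀ x → n · x ≡ 0#
  card·x≡0 x = identityˡ-unique (n · x) (∑.∑ᴷ id) (begin
    n · x + ∑.∑ᴷ id             ≡⟨ cong (_+ ∑.∑ᴷ id) (sym (∑.sum-replicate n)) ⟩
    ∑.∑ᴷ (λ _ → x) + ∑.∑ᴷ id    ≡⟨ sym (∑.∑-distrib-+ (λ _ → x) from) ⟩
    ∑.∑ᴷ (x +_)                 ≡⟨ ∑.∑ᴷ-reindex (x +_) (- x +_) x+[-x+y]≡y -x+[x+y]≡y id ⟩
    ∑.∑ᴷ id                     ∎)
    where
    open ≡-Reasoning
    x+[-x+y]≡y : ∀ y → x + (- x + y) ≡ y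
    x+[-x+y]≡y y = solve 2 (λ x y → x :+ (:- x :+ y) := y) refl x y
    -x+[x+y]≡y : ∀ y → - x + (x + y) ≡ y
    -x+[x+y]≡y y = solve 2 (λ x y → :- x :+ (x :+ y) := y) refl x y

  x*x≡0⇒x≡0 : ∀ {x} → x * x ≡ 0# → x ≡ 0#
  x*x≡0⇒x≡0 x²≡0 = Sum.[ id , id ] (x*y≡0⇒x≡0⊎y≡0 x²≡0)

  m^k·1≡0⇒m·1≡0 : ∀ m k → (m ℕ.^ k) · 1# ≡ 0# → m · 1# ≡ 0#
  m^k·1≡0⇒m·1≡0 m zero    1+0≡0 = ⊥-elim (0≢1 (sym (trans (sym (+-identityʳ 1#)) 1+0≡0)))
  m^k·1≡0⇒m·1≡0 m (suc k) m^[1+k]·1≡0 with x*y≡0⇒x≡0⊎y≡0 (trans (sym (×1-homo-* m (m ℕ.^ k))) m^[1+k]·1≡0)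
  ... | inj₁ m·1≡0   = m·1≡0
  ... | inj₂ m^k·1≡0 = m^k·1≡0⇒m·1≡0 m k m^k·1≡0

  private
    nonzero-or-1 : Carrier → Carrier
    nonzero-or-1 y with y ≟ 0#
    ... | yes _ = 1#
    ... | no _  = y

    nonzero-or-1≢0 : ∀ y → nonzero-or-1 y ≢ 0#
    nonzero-or-1≢0 y with y ≟ 0#
    ... | yes _  = λ 1≡0 → 0≢1 (sym 1≡0)
    ... | no y≢0 = y≢0

    product≢0 : ∀ {k} (t : Fin k → Carrier) → (∀ i → t i ≢ 0#) → ∏.sum t ≢ 0#
    product≢0 {zero}  t t≢0 1≡0 = 0≢1 (sym 1≡0)
    product≢0 {suc k} t t≢0     = *-≢0 (t≢0 Fin.zero) (product≢0 (t ∘ Fin.suc) (t≢0 ∘ Fin.suc))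

    0^≡0 : ∀ {k} → Fin k → 0# ^ k ≡ 0#
    0^≡0 {suc k} _ = zeroˡ (0# ^ k)

  -- For x ≢ 0, y ↦ x * y permutes the elements; comparing the products of nonzero-or-1 (x * y)
  -- and of nonzero-or-1 y over all y gives P * x ^ n ≡ P * x.
  fermat : ∀ x → x ^ n ≡ x
  fermat x with x ≟ 0#
  ... | yes refl = 0^≡0 (to 0#)
  ... | no x≢0   = *-cancelˡ P≢0 (begin
    P * x ^ n                                       ≡⟨ *-comm P (x ^ n) ⟩
    x ^ n * P                                       ≡⟨ cong (_* P) (trans (^≡Exp^ x n) (sym (∏.sum-replicate n))) ⟩
    ∏.∑ᴷ (λ _ → x) * P                              ≡⟨ sym (∏.∑-distrib-+ (λ _ → x) (nonzero-or-1 ∘ from)) ⟩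
    ∏.∑ᴷ (λ y → x * nonzero-or-1 y)                 ≡⟨ ∏.sum-cong-≗ (scale ∘ from) ⟩
    ∏.∑ᴷ (λ y → nonzero-or-1 (x * y) * x-at-0 y)    ≡⟨ ∏.∑-distrib-+ (nonzero-or-1 ∘ (x *_) ∘ from) (x-at-0 ∘ from) ⟩
    ∏.∑ᴷ (nonzero-or-1 ∘ (x *_)) * ∏.∑ᴷ x-at-0
      ≡⟨ cong₂ _*_ (∏.∑ᴷ-reindex (x *_) (x ⁻¹ *_) x*[x⁻¹*y]≡y x⁻¹*[x*y]≡y nonzero-or-1) (∏.∑ᴷ-single x-at-0 0# x-at-0≡1) ⟩
    P * x-at-0 0#                                   ≡⟨ cong (P *_) x-at-0[0]≡x ⟩
    P * x                                           ∎)
    where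
    open ≡-Reasoning
    P : Carrier
    P = ∏.∑ᴷ nonzero-or-1
    P≢0 : P ≢ 0#
    P≢0 = product≢0 (nonzero-or-1 ∘ from) (nonzero-or-1≢0 ∘ from)

    x-at-0 : Carrier → Carrier
    x-at-0 y with y ≟ 0#
    ... | yes _ = x
    ... | no _  = 1#

    x-at-0[0]≡x : x-at-0 0# ≡ x
    x-at-0[0]≡x with 0# ≟ 0#
    ... | yes _  = refl
    ... | no 0≢0 = ⊥-elim (0≢0 refl)

    x-at-0≡1 : ∀ y → y ≢ 0# → x-at-0 y ≡ 1#
    x-at-0≡1 y y≢0 with y ≟ 0#
    ... | yes y≡0 = ⊥-elim (y≢0 y≡0)
    ... | no _    = refl

    scale : ∀ y → x * nonzero-or-1 y ≡ nonzero-or-1 (x * y) * x-at-0 y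
    scale y with y ≟ 0# | (x * y) ≟ 0#
    ... | yes _   | yes _    = *-comm x 1#
    ... | yes y≡0 | no xy≢0  = ⊥-elim (xy≢0 (trans (cong (x *_) y≡0) (zeroʳ x)))
    ... | no y≢0  | yes xy≡0 = ⊥-elim (*-≢0 x≢0 y≢0 xy≡0)
    ... | no _    | no _     = sym (*-identityʳ (x * y))

    x*[x⁻¹*y]≡y : ∀ y → x * (x ⁻¹ * y) ≡ y
    x*[x⁻¹*y]≡y y = trans (sym (*-assoc x (x ⁻¹) y)) (trans (cong (_* y) (inverse x x≢0)) (*-identityˡ y))

    x⁻¹*[x*y]≡y : ∀ y → x ⁻¹ * (x * y) ≡ y
    x⁻¹*[x*y]≡y y = trans (sym (*-assoc (x ⁻¹) x y)) (trans (cong (_* y) (x⁻¹*x≡1 x≢0)) (*-identityˡ y))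

module Frobenius (F : Field) where
  open Field F
  open FieldProperties F
  open ≡ using (refl; sym; trans; cong; cong₂; module ≡-Reasoning)
  import Algebra.Properties.CommutativeSemiring.Binomial (CommutativeRing.commutativeSemiring commutativeRing) as Binomial
  open import Algebra.Properties.CommutativeMonoid.Sum +-commutativeMonoid using (sum; sum-init-last; sum-cong-≗; sum-replicate-zero)
  open PrimeProperties using (prime∣choose)
  open import Data.Nat.Divisibility using (_∣_; divides)

  sum-of-ends : ∀ {r} (t : Fin (suc (suc r)) → Carrier) → (∀ j → t (Fin.suc (Fin.inject₁ j)) ≡ 0#) →
                sum t ≡ t Fin.zero + t (Fin.fromℕ (suc r))
  sum-of-ends {r} t interior≡0 = cong (t Fin.zero +_) (begin
    sum (t ∘ Fin.suc)                                        ≡⟨ sum-init-last (t ∘ Fin.suc) ⟩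
    sum (t ∘ Fin.suc ∘ Fin.inject₁) + t (Fin.fromℕ (suc r))  ≡⟨ cong (_+ _) (trans (sum-cong-≗ interior≡0) (sum-replicate-zero r)) ⟩
    0# + t (Fin.fromℕ (suc r))                               ≡⟨ +-identityˡ _ ⟩
    t (Fin.fromℕ (suc r))                                    ∎)
    where open ≡-Reasoning

  module _ {p} (p-prime : Prime p) (char-p : p · 1# ≡ 0#) where

    p∣m⇒m·x≡0 : ∀ {m} x → p ∣ m → m · x ≡ 0#
    p∣m⇒m·x≡0 {m} x (divides d refl) = begin
      (d ℕ.* p) · x             ≡⟨ cong ((d ℕ.* p) ·_) (sym (*-identityˡ x)) ⟩
      (d ℕ.* p) · (1# * x)      ≡⟨ sym (×-assoc-* (d ℕ.* p) 1# x) ⟩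
      (d ℕ.* p) · 1# * x        ≡⟨ cong (_* x) (×1-homo-* d p) ⟩
      d · 1# * p · 1# * x       ≡⟨ cong (λ c → d · 1# * c * x) char-p ⟩
      d · 1# * 0# * x           ≡⟨ cong (_* x) (zeroʳ (d · 1#)) ⟩
      0# * x                    ≡⟨ zeroˡ x ⟩
      0#                        ∎
      where open ≡-Reasoning

    ^p-+ : ∀ x y → (x + y) ^ p ≡ x ^ p + y ^ p
    ^p-+ x y = binomial-at refl
      where
      open ≡-Reasoning
      open Binomial using (binomialTerm)
      open import Data.Nat.Combinatorics using (nCn≡1)
      binomial-at : ∀ {n} → n ≡ p → (x + y) ^ n ≡ x ^ n + y ^ n
      binomial-at {zero}  refl = ⊥-elim (ℕ.n≮0 (ℕ.nonTrivial⇒n>1 0 {{Data.Nat.Primality.prime⇒nonTrivial p-prime}}))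
      binomial-at {suc r} refl = begin
        (x + y) ^ p                           ≡⟨ trans (^≡Exp^ (x + y) p) (Binomial.theorem p x y) ⟩
        sum (binomialTerm x y p)              ≡⟨ sum-of-ends (binomialTerm x y p) interior≡0 ⟩
        binomialTerm x y p Fin.zero + binomialTerm x y p (Fin.fromℕ p) ≡⟨ cong₂ _+_ first≡y^p last≡x^p ⟩
        y ^ p + x ^ p                         ≡⟨ +-comm (y ^ p) (x ^ p) ⟩
        x ^ p + y ^ p                         ∎
        where
        first≡y^p : binomialTerm x y p Fin.zero ≡ y ^ p
        first≡y^p = trans (+-identityʳ _) (trans (*-identityˡ _) (sym (^≡Exp^ y p)))
        last≡x^p : binomialTerm x y p (Fin.fromℕ p) ≡ x ^ p
        last≡x^p rewrite Fin.toℕ-fromℕ r | nCn≡1 p | ℕ.n∸n≡0 r =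
          trans (+-identityʳ _) (trans (*-identityʳ _) (sym (^≡Exp^ x p)))
        interior≡0 : ∀ j → binomialTerm x y p (Fin.suc (Fin.inject₁ j)) ≡ 0#
        interior≡0 j = p∣m⇒m·x≡0 _ (prime∣choose p-prime (ℕ.s≤s ℕ.z≤n)
          (ℕ.s≤s (≡.subst (ℕ._< r) (sym (Fin.toℕ-inject₁ j)) (Fin.toℕ<n j))))

    ^p^k-+ : ∀ k x y → (x + y) ^ (p ℕ.^ k) ≡ x ^ (p ℕ.^ k) + y ^ (p ℕ.^ k)
    ^p^k-+ zero    x y = trans (*-identityʳ (x + y)) (sym (cong₂ _+_ (*-identityʳ x) (*-identityʳ y)))
    ^p^k-+ (suc k) x y = begin
      (x + y) ^ (p ℕ.* p ℕ.^ k)                 ≡⟨ sym (^-*-assoc (x + y) p (p ℕ.^ k)) ⟩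
      ((x + y) ^ p) ^ (p ℕ.^ k)                 ≡⟨ cong (_^ (p ℕ.^ k)) (^p-+ x y) ⟩
      (x ^ p + y ^ p) ^ (p ℕ.^ k)               ≡⟨ ^p^k-+ k (x ^ p) (y ^ p) ⟩
      (x ^ p) ^ (p ℕ.^ k) + (y ^ p) ^ (p ℕ.^ k) ≡⟨ cong₂ _+_ (^-*-assoc x p (p ℕ.^ k)) (^-*-assoc y p (p ℕ.^ k)) ⟩
      x ^ (p ℕ.* p ℕ.^ k) + y ^ (p ℕ.* p ℕ.^ k) ∎
      where open ≡-Reasoning

record IsInvolutiveAutomorphism (F : Field) (φ : Field.Carrier F → Field.Carrier F) : Set where
  open Field F
  field
    φ-+          : ∀ x y → φ (x + y) ≡ φ x + φ y
    φ-*          : ∀ x y → φ (x * y) ≡ φ x * φ y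
    φ-involutive : ∀ x → φ (φ x) ≡ x

module Conjugation (p m : ℕ) (p-prime : Prime p) (K : FiniteField ((p ℕ.^ m) ℕ.^ 2)) where
  open FiniteField K
  open FieldProperties field′
  open FiniteFieldProperties field′ card
  open Plane (p ℕ.^ m) K using (conj)
  open ≡ using (refl; sym; trans; cong)

  private
    q : ℕ
    q = p ℕ.^ m

  char-p : p · 1# ≡ 0#
  char-p = m^k·1≡0⇒m·1≡0 p (m ℕ.* 2) (trans (cong (_· 1#) (sym (ℕ.^-*-assoc p m 2))) (card·x≡0 1#))

  conj-isInvolutiveAutomorphism : IsInvolutiveAutomorphism field′ conj
  conj-isInvolutiveAutomorphism = record
    { φ-+          = Frobenius.^p^k-+ field′ p-prime char-p m
    ; φ-*          = λ x y → ^-distrib-* x y q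
    ; φ-involutive = λ x → trans (^-*-assoc x q q) (trans (cong (x ^_) (cong (q ℕ.*_) (sym (ℕ.*-identityʳ q)))) (fermat x))
    }

  2≢0 : p ≢ 2 → 2# ≢ 0#
  2≢0 p≢2 2≡0 with PrimeProperties.odd-prime p-prime p≢2
  ... | k , refl = 0≢1 (sym (trans (sym (2#≡0⇒[1+2k]·1≡1 2≡0 k)) char-p))

module Geometry {n} (q : ℕ) (K : FiniteField n)
                (conj-isInvolutiveAutomorphism : IsInvolutiveAutomorphism (FiniteField.field′ K) (Plane.conj q K))
                (2≢0 : FiniteField.2# K ≢ FiniteField.0# K) where
  open FiniteField K
  open Plane q K
  open IsInvolutiveAutomorphism conj-isInvolutiveAutomorphism
    renaming (φ-+ to conj-+; φ-* to conj-*; φ-involutive to conj-involutive)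
  open FieldProperties field′
  open FiniteFieldProperties field′ card using (x*y≡0⇒x≡0⊎y≡0; x*y≡0⇔x≡0⊎y≡0; x*x≡0⇒x≡0)
  open ≡ using (refl; sym; trans; cong; cong₂; module ≡-Reasoning)

  conj-0 : conj 0# ≡ 0#
  conj-0 = identityˡ-unique (conj 0#) (conj 0#) (sym (trans (cong conj (sym (+-identityʳ 0#))) (conj-+ 0# 0#)))

  conj-1 : conj 1# ≡ 1#
  conj-1 = 1^n≡1 q

  conj-2 : conj 2# ≡ 2#
  conj-2 = trans (conj-+ 1# 1#) (cong₂ _+_ conj-1 conj-1)

  conj-neg : ∀ x → conj (- x) ≡ - conj x
  conj-neg x = inverseʳ-unique (conj x) (conj (- x)) (trans (sym (conj-+ x (- x))) (trans (cong conj (-‿inverseʳ x)) conj-0))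

  conj-- : ∀ x y → conj (x - y) ≡ conj x - conj y
  conj-- x y = trans (conj-+ x (- y)) (cong (conj x +_) (conj-neg y))

  conj-⁻¹ : ∀ {x} → x ≢ 0# → conj (x ⁻¹) ≡ conj x ⁻¹
  conj-⁻¹ {x} x≢0 = x*y≡1⇒y≡x⁻¹ (trans (sym (conj-* x (x ⁻¹))) (trans (cong conj (inverse x x≢0)) conj-1))

  anti-fixed : ∀ {c} → c ≡ - conj c → conj c ≡ - c
  anti-fixed {c} c≡-conj-c = sym (trans (cong -_ c≡-conj-c) (-‿involutive (conj c)))

  conj≡0⇒≡0 : ∀ {x} → conj x ≡ 0# → x ≡ 0#
  conj≡0⇒≡0 {x} conj-x≡0 = trans (sym (conj-involutive x)) (trans (cong conj conj-x≡0) conj-0)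

  x≡-x⇒x≡0 : ∀ {x} → x ≡ - x → x ≡ 0#
  x≡-x⇒x≡0 {x} x≡-x = *-cancelˡ 2≢0 (begin
    2# * x       ≡⟨ solve 1 (λ x → num 2 :* x := x :- :- x) refl x ⟩
    x - - x      ≡⟨ x≡y⇒x-y≡0 x≡-x ⟩
    0#           ≡⟨ sym (zeroʳ 2#) ⟩
    2# * 0#      ∎)
    where open ≡-Reasoning

  module TangentCircles (γ : Carrier) (γ²≢γ̄² : γ ^ 2 ≢ conj γ ^ 2) where
    γ̄ δ σ g 4g : Carrier
    γ̄  = conj γ
    δ  = γ - γ̄
    σ  = γ + γ̄
    g  = γ * γ̄
    4g = 2# * 2# * g

    δ*σ≢0 : δ * σ ≢ 0#
    δ*σ≢0 δσ≡0 = γ²≢γ̄² (x-y≡0⇒x≡y (trans γ²-γ̄²≡δ*σ δσ≡0))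
      where
      γ²-γ̄²≡δ*σ : γ ^ 2 - γ̄ ^ 2 ≡ δ * σ
      γ²-γ̄²≡δ*σ = solve 2 (λ a b → a :* (a :* num 1) :- b :* (b :* num 1) := (a :- b) :* (a :+ b)) refl γ γ̄

    δ≢0 : δ ≢ 0#
    δ≢0 δ≡0 = δ*σ≢0 (trans (cong (_* σ) δ≡0) (zeroˡ σ))

    σ≢0 : σ ≢ 0#
    σ≢0 σ≡0 = δ*σ≢0 (trans (cong (δ *_) σ≡0) (zeroʳ δ))

    γ≢0 : γ ≢ 0#
    γ≢0 γ≡0 = δ≢0 (begin
      γ - conj γ    ≡⟨ cong (λ x → x - conj x) γ≡0 ⟩
      0# - conj 0#  ≡⟨ cong (λ t → 0# - t) conj-0 ⟩
      0# - 0#       ≡⟨ -‿inverseʳ 0# ⟩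
      0#            ∎)
      where open ≡-Reasoning

    γ̄≢0 : γ̄ ≢ 0#
    γ̄≢0 γ̄≡0 = γ≢0 (conj≡0⇒≡0 γ̄≡0)

    g≢0 : g ≢ 0#
    g≢0 = *-≢0 γ≢0 γ̄≢0

    4g≢0 : 4g ≢ 0#
    4g≢0 = *-≢0 (*-≢0 2≢0 2≢0) g≢0

    conj-γ̄ : conj γ̄ ≡ γ
    conj-γ̄ = conj-involutive γ

    conj-δ : conj δ ≡ - δ
    conj-δ = trans (conj-- γ γ̄) (trans (cong (λ t → γ̄ - t) conj-γ̄) (solve 2 (λ a b → b :- a := :- (a :- b)) refl γ γ̄))

    conj-σ : conj σ ≡ σ
    conj-σ = trans (conj-+ γ γ̄) (trans (cong (γ̄ +_) conj-γ̄) (+-comm γ̄ γ))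

    OnLine : Carrier → Set
    OnLine z = B2 γ 0# (just z)

    -- On the line B²(γ,0), μ c z vanishes at the midpoint of the chord cut out by a circle centred at c.
    μ : Carrier → Carrier → Carrier
    μ c z = 2# * (γ̄ * z) - c * σ

    4g*circle-on-line : ∀ {c z} → conj c ≡ - c → OnLine z →
      4g * ((z - c) * (conj z - conj c)) ≡ (c * δ) * (c * δ) - μ c z * μ c z
    4g*circle-on-line {c} {z} conj-c≡-c on-line = begin
      4g * ((z - c) * (conj z - conj c))
        ≡⟨ cong (λ t → 4g * ((z - c) * (conj z - t))) conj-c≡-c ⟩
      4g * ((z - c) * (conj z - - c))
        ≡⟨ solve 5 (λ a b c z w → num 2 :* num 2 :* (a :* b) :* ((z :- c) :* (w :- :- c))
                               := num 2 :* num 2 :* ((b :* z :- b :* c) :* (a :* w :+ a :* c))) refl γ γ̄ c z (conj z) ⟩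
      2# * 2# * ((γ̄ * z - γ̄ * c) * (γ * conj z + γ * c))
        ≡⟨ cong (λ t → 2# * 2# * ((γ̄ * z - γ̄ * c) * (t + γ * c))) (inverseʳ-unique (γ̄ * z) (γ * conj z) on-line) ⟩
      2# * 2# * ((γ̄ * z - γ̄ * c) * (- (γ̄ * z) + γ * c))
        ≡⟨ solve 4 (λ a b c z → num 2 :* num 2 :* ((b :* z :- b :* c) :* (:- (b :* z) :+ a :* c))
                             := (c :* (a :- b)) :* (c :* (a :- b))
                                :- (num 2 :* (b :* z) :- c :* (a :+ b)) :* (num 2 :* (b :* z) :- c :* (a :+ b))) refl γ γ̄ c z ⟩
      (c * δ) * (c * δ) - μ c z * μ c z
        ∎
      where open ≡-Reasoning

    reflect : Carrier → Carrier → Carrier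
    reflect c z = c * σ * γ̄ ⁻¹ - z

    γ̄*reflect : ∀ c z → γ̄ * reflect c z ≡ c * σ - γ̄ * z
    γ̄*reflect c z = begin
      γ̄ * (c * σ * γ̄ ⁻¹ - z)
        ≡⟨ solve 4 (λ b x z i → b :* (x :* i :- z) := x :* (b :* i) :- b :* z) refl γ̄ (c * σ) z (γ̄ ⁻¹) ⟩
      c * σ * (γ̄ * γ̄ ⁻¹) - γ̄ * z
        ≡⟨ cong (λ t → c * σ * t - γ̄ * z) (inverse γ̄ γ̄≢0) ⟩
      c * σ * 1# - γ̄ * z
        ≡⟨ cong (λ t → t - γ̄ * z) (*-identityʳ (c * σ)) ⟩
      c * σ - γ̄ * z
        ∎
      where open ≡-Reasoning

    μ-reflect : ∀ c z → μ c (reflect c z) ≡ - μ c z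
    μ-reflect c z = trans (cong (λ t → 2# * t - c * σ) (γ̄*reflect c z))
      (solve 2 (λ x u → num 2 :* (x :- u) :- x := :- (num 2 :* u :- x)) refl (c * σ) (γ̄ * z))

    reflect-on-line : ∀ {c z} → conj c ≡ - c → OnLine z → OnLine (reflect c z)
    reflect-on-line {c} {z} conj-c≡-c on-line = begin
      γ̄ * reflect c z + γ * conj (reflect c z)
        ≡⟨ cong₂ _+_ (γ̄*reflect c z) γ*conj-reflect ⟩
      (c * σ - γ̄ * z) + (- (c * σ) - γ * conj z)
        ≡⟨ solve 3 (λ x u w → (x :- u) :+ (:- x :- w) := :- (u :+ w)) refl (c * σ) (γ̄ * z) (γ * conj z) ⟩
      - (γ̄ * z + γ * conj z)
        ≡⟨ cong -_ on-line ⟩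
      - 0#
        ≡⟨ -0#≈0# ⟩
      0#
        ∎
      where
      open ≡-Reasoning
      γ*conj-reflect : γ * conj (reflect c z) ≡ - (c * σ) - γ * conj z
      γ*conj-reflect = begin
        γ * conj (c * σ * γ̄ ⁻¹ - z)
          ≡⟨ cong (γ *_) (trans (conj-- _ z) (cong (_- conj z) (trans (conj-* _ _) (cong₂ _*_ (conj-* c σ) (conj-⁻¹ γ̄≢0))))) ⟩
        γ * (conj c * conj σ * conj γ̄ ⁻¹ - conj z)
          ≡⟨ cong₂ (λ t u → γ * (t * u - conj z)) (cong₂ _*_ conj-c≡-c conj-σ) (cong _⁻¹ conj-γ̄) ⟩
        γ * (- c * σ * γ ⁻¹ - conj z)
          ≡⟨ solve 5 (λ a c s i w → a :* (:- c :* s :* i :- w) := :- (c :* s) :* (a :* i) :- a :* w) refl γ c σ (γ ⁻¹) (conj z) ⟩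
        - (c * σ) * (γ * γ ⁻¹) - γ * conj z
          ≡⟨ cong (λ t → - (c * σ) * t - γ * conj z) (inverse γ γ≢0) ⟩
        - (c * σ) * 1# - γ * conj z
          ≡⟨ cong (λ t → t - γ * conj z) (*-identityʳ (- (c * σ))) ⟩
        - (c * σ) - γ * conj z
          ∎

    reflect-on-circle : ∀ {c r z} → conj c ≡ - c → OnLine z → B1 c r (just z) → B1 c r (just (reflect c z))
    reflect-on-circle {c} {r} {z} conj-c≡-c on-line on-circle = *-cancelˡ 4g≢0 (begin
      4g * ((z* - c) * (conj z* - conj c))      ≡⟨ 4g*circle-on-line conj-c≡-c (reflect-on-line conj-c≡-c on-line) ⟩
      (c * δ) * (c * δ) - μ c z* * μ c z*       ≡⟨ cong (λ t → (c * δ) * (c * δ) - t * t) (μ-reflect c z) ⟩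
      (c * δ) * (c * δ) - - μ c z * - μ c z     ≡⟨ cong ((c * δ) * (c * δ) +_) (cong -_ (-x*-y≡x*y (μ c z) (μ c z))) ⟩
      (c * δ) * (c * δ) - μ c z * μ c z         ≡⟨ sym (4g*circle-on-line conj-c≡-c on-line) ⟩
      4g * ((z - c) * (conj z - conj c))        ≡⟨ cong (4g *_) on-circle ⟩
      4g * r                                    ∎)
      where
      open ≡-Reasoning
      z* : Carrier
      z* = reflect c z

    tangent-to-line⇒radius : ∀ {c r} → conj c ≡ - c → Tangent (B1 c r) (B2 γ 0#) → 4g * r ≡ (c * δ) * (c * δ)
    tangent-to-line⇒radius _ (_ , nothing , (() , _) , _)
    tangent-to-line⇒radius {c} {r} conj-c≡-c (_ , just z , (on-circle , on-line) , unique) = begin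
      4g * r                                ≡⟨ cong (4g *_) (sym on-circle) ⟩
      4g * ((z - c) * (conj z - conj c))    ≡⟨ 4g*circle-on-line conj-c≡-c on-line ⟩
      (c * δ) * (c * δ) - μ c z * μ c z     ≡⟨ cong (λ t → (c * δ) * (c * δ) - t * t) μ≡0 ⟩
      (c * δ) * (c * δ) - 0# * 0#           ≡⟨ solve 1 (λ x → x :- num 0 :* num 0 := x) refl ((c * δ) * (c * δ)) ⟩
      (c * δ) * (c * δ)                     ∎
      where
      open ≡-Reasoning
      reflect-z≡z : reflect c z ≡ z
      reflect-z≡z = Maybe.just-injective
        (unique (just (reflect c z)) (reflect-on-circle conj-c≡-c on-line on-circle) (reflect-on-line conj-c≡-c on-line))
      μ≡0 : μ c z ≡ 0#
      μ≡0 = x≡-x⇒x≡0 (trans (cong (μ c) (sym reflect-z≡z)) (μ-reflect c z))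

    distinct⇒c₁≢c₂ : ∀ {c₁ r₁ c₂ r₂} → 4g * r₁ ≡ (c₁ * δ) * (c₁ * δ) → 4g * r₂ ≡ (c₂ * δ) * (c₂ * δ) →
                     Distinct (B1 c₁ r₁) (B1 c₂ r₂) → c₁ ≢ c₂
    distinct⇒c₁≢c₂ {c₁} {r₁} radius₁ radius₂ distinct refl =
      distinct (λ P → ≡.subst (λ r → B1 c₁ r₁ P ⇔ B1 c₁ r P) (*-cancelˡ 4g≢0 (trans radius₁ (sym radius₂))) ⇔.refl)

    8g : Carrier
    8g = 2# * 4g

    8g≢0 : 8g ≢ 0#
    8g≢0 = *-≢0 2≢0 4g≢0

    conj-8g : conj 8g ≡ 8g
    conj-8g = begin
      conj (2# * (2# * 2# * g))          ≡⟨ trans (conj-* 2# _) (cong (_* conj (2# * 2# * g)) conj-2) ⟩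
      2# * conj (2# * 2# * g)            ≡⟨ cong (2# *_) (trans (conj-* (2# * 2#) g) (cong₂ _*_ conj-4 conj-g)) ⟩
      2# * (2# * 2# * g)                 ∎
      where
      open ≡-Reasoning
      conj-4 : conj (2# * 2#) ≡ 2# * 2#
      conj-4 = trans (conj-* 2# 2#) (cong₂ _*_ conj-2 conj-2)
      conj-g : conj g ≡ g
      conj-g = trans (conj-* γ γ̄) (trans (cong (γ̄ *_) conj-γ̄) (*-comm γ̄ γ))

    Δ : Carrier → Carrier → Carrier
    Δ c c′ = (δ * (c + c′)) * (δ * (c + c′)) + 4g * ((c - c′) * (c - c′))

    Δ-sym : ∀ c c′ → Δ c c′ ≡ Δ c′ c
    Δ-sym c c′ = solve 4 (λ a b c d →
        (a :- b) :* (c :+ d) :* ((a :- b) :* (c :+ d)) :+ num 2 :* num 2 :* (a :* b) :* ((c :- d) :* (c :- d))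
      := (a :- b) :* (d :+ c) :* ((a :- b) :* (d :+ c)) :+ num 2 :* num 2 :* (a :* b) :* ((d :- c) :* (d :- c)))
      refl γ γ̄ c c′

    [8g]²*halfChord²≡σ²*Δ : ∀ {c c′ r h} → 4g * r ≡ (c * δ) * (c * δ) → 8g * h ≡ (c + c′) * (σ * σ) →
                          8g * 8g * (r + (h - c) * (h - c)) ≡ σ * σ * Δ c c′
    [8g]²*halfChord²≡σ²*Δ {c} {c′} {r} {h} radius 8g*h≡ = begin
      8g * 8g * (r + (h - c) * (h - c))
        ≡⟨ solve 5 (λ a b r h c → num 2 :* (num 2 :* num 2 :* (a :* b)) :* (num 2 :* (num 2 :* num 2 :* (a :* b))) :* (r :+ (h :- c) :* (h :- c))
                := num 2 :* num 2 :* num 2 :* num 2 :* (a :* b) :* (num 2 :* num 2 :* (a :* b) :* r)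
                   :+ (num 2 :* (num 2 :* num 2 :* (a :* b)) :* h :- num 2 :* (num 2 :* num 2 :* (a :* b)) :* c)
                      :* (num 2 :* (num 2 :* num 2 :* (a :* b)) :* h :- num 2 :* (num 2 :* num 2 :* (a :* b)) :* c))
                refl γ γ̄ r h c ⟩
      2# * 2# * 2# * 2# * g * (4g * r) + (8g * h - 8g * c) * (8g * h - 8g * c)
        ≡⟨ cong₂ (λ t u → 2# * 2# * 2# * 2# * g * t + (u - 8g * c) * (u - 8g * c)) radius 8g*h≡ ⟩
      2# * 2# * 2# * 2# * g * ((c * δ) * (c * δ)) + ((c + c′) * (σ * σ) - 8g * c) * ((c + c′) * (σ * σ) - 8g * c)
        ≡⟨ solve 4 (λ a b c d → num 2 :* num 2 :* num 2 :* num 2 :* (a :* b) :* ((c :* (a :- b)) :* (c :* (a :- b)))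
                   :+ ((c :+ d) :* ((a :+ b) :* (a :+ b)) :- num 2 :* (num 2 :* num 2 :* (a :* b)) :* c)
                      :* ((c :+ d) :* ((a :+ b) :* (a :+ b)) :- num 2 :* (num 2 :* num 2 :* (a :* b)) :* c)
                := (a :+ b) :* (a :+ b) :* ((a :- b) :* (c :+ d) :* ((a :- b) :* (c :+ d)) :+ num 2 :* num 2 :* (a :* b) :* ((c :- d) :* (c :- d))))
                refl γ γ̄ c c′ ⟩
      σ * σ * Δ c c′
        ∎
      where open ≡-Reasoning

    module CircleTangency {c₁ r₁ c₂ r₂ : Carrier} (conj-c₁ : conj c₁ ≡ - c₁) (conj-c₂ : conj c₂ ≡ - c₂)
                          (radius₁ : 4g * r₁ ≡ (c₁ * δ) * (c₁ * δ)) (radius₂ : 4g * r₂ ≡ (c₂ * δ) * (c₂ * δ))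
                          (c₁≢c₂ : c₁ ≢ c₂) where
      -- The common points of the two circles lie on the radical line z̄ = z − 2h, symmetric about h.
      h : Carrier
      h = (c₁ + c₂) * (σ * σ) * 8g ⁻¹

      c₁-c₂≢0 : c₁ - c₂ ≢ 0#
      c₁-c₂≢0 = c₁≢c₂ ∘ x-y≡0⇒x≡y

      8g*h : 8g * h ≡ (c₁ + c₂) * (σ * σ)
      8g*h = begin
        8g * ((c₁ + c₂) * (σ * σ) * 8g ⁻¹)   ≡⟨ solve 3 (λ e x i → e :* (x :* i) := x :* (e :* i)) refl 8g _ (8g ⁻¹) ⟩
        (c₁ + c₂) * (σ * σ) * (8g * 8g ⁻¹)   ≡⟨ cong ((c₁ + c₂) * (σ * σ) *_) (inverse 8g 8g≢0) ⟩
        (c₁ + c₂) * (σ * σ) * 1#             ≡⟨ *-identityʳ _ ⟩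
        (c₁ + c₂) * (σ * σ)                  ∎
        where open ≡-Reasoning

      conj-h : conj h ≡ - h
      conj-h = *-cancelˡ 8g≢0 (begin
        8g * conj h                    ≡⟨ cong (_* conj h) (sym conj-8g) ⟩
        conj 8g * conj h               ≡⟨ sym (conj-* 8g h) ⟩
        conj (8g * h)                  ≡⟨ cong conj 8g*h ⟩
        conj ((c₁ + c₂) * (σ * σ))     ≡⟨ trans (conj-* _ _) (cong₂ _*_ (conj-+ c₁ c₂) (conj-* σ σ)) ⟩
        (conj c₁ + conj c₂) * (conj σ * conj σ) ≡⟨ cong₂ (λ t u → t * (u * u)) (cong₂ _+_ conj-c₁ conj-c₂) conj-σ ⟩
        (- c₁ + - c₂) * (σ * σ)        ≡⟨ solve 3 (λ a b s → (:- a :+ :- b) :* s := :- ((a :+ b) :* s)) refl c₁ c₂ (σ * σ) ⟩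
        - ((c₁ + c₂) * (σ * σ))        ≡⟨ cong -_ (sym 8g*h) ⟩
        - (8g * h)                     ≡⟨ solve 2 (λ e h → :- (e :* h) := e :* :- h) refl 8g h ⟩
        8g * - h                       ∎)
        where open ≡-Reasoning

      radical-line : ∀ {z} → B1 c₁ r₁ (just z) → B1 c₂ r₂ (just z) → conj z ≡ z - 2# * h
      radical-line {z} on₁ on₂ = begin
        conj z              ≡⟨ solve 2 (λ z w → w := z :- (z :- w)) refl z (conj z) ⟩
        z - (z - conj z)    ≡⟨ cong (λ t → z - t) (*-cancelˡ 4g≢0 4g*[z-z̄]≡4g*2h) ⟩
        z - 2# * h          ∎
        where
        open ≡-Reasoning
        on-circle : ∀ {c r} → conj c ≡ - c → B1 c r (just z) → (z - c) * (conj z - - c) ≡ r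
        on-circle conj-c≡-c = ≡.subst (λ t → (z - _) * (conj z - t) ≡ _) conj-c≡-c

        [c₁-c₂]*[4g*[z-z̄]-8g*h]≡0 : (c₁ - c₂) * (4g * (z - conj z) - 8g * h) ≡ 0#
        [c₁-c₂]*[4g*[z-z̄]-8g*h]≡0 = begin
          (c₁ - c₂) * (4g * (z - conj z) - 8g * h)
            ≡⟨ cong (λ t → (c₁ - c₂) * (4g * (z - conj z) - t)) 8g*h ⟩
          (c₁ - c₂) * (4g * (z - conj z) - (c₁ + c₂) * (σ * σ))
            ≡⟨ solve 6 (λ a b c d z w → (c :- d) :* (num 2 :* num 2 :* (a :* b) :* (z :- w) :- (c :+ d) :* ((a :+ b) :* (a :+ b)))
                   := num 2 :* num 2 :* (a :* b) :* ((z :- c) :* (w :- :- c) :- (z :- d) :* (w :- :- d))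
                      :- ((c :* (a :- b)) :* (c :* (a :- b)) :- (d :* (a :- b)) :* (d :* (a :- b))))
                   refl γ γ̄ c₁ c₂ z (conj z) ⟩
          4g * ((z - c₁) * (conj z - - c₁) - (z - c₂) * (conj z - - c₂)) - ((c₁ * δ) * (c₁ * δ) - (c₂ * δ) * (c₂ * δ))
            ≡⟨ cong₂ (λ t u → 4g * (t - u) - _) (on-circle conj-c₁ on₁) (on-circle conj-c₂ on₂) ⟩
          4g * (r₁ - r₂) - ((c₁ * δ) * (c₁ * δ) - (c₂ * δ) * (c₂ * δ))
            ≡⟨ solve 5 (λ k a b x y → k :* (a :- b) :- (x :- y) := (k :* a :- x) :- (k :* b :- y)) refl 4g r₁ r₂ _ _ ⟩
          (4g * r₁ - (c₁ * δ) * (c₁ * δ)) - (4g * r₂ - (c₂ * δ) * (c₂ * δ))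
            ≡⟨ cong₂ _-_ (x≡y⇒x-y≡0 radius₁) (x≡y⇒x-y≡0 radius₂) ⟩
          0# - 0#
            ≡⟨ -‿inverseʳ 0# ⟩
          0#
            ∎

        4g*[z-z̄]≡4g*2h : 4g * (z - conj z) ≡ 4g * (2# * h)
        4g*[z-z̄]≡4g*2h = trans (x-y≡0⇒x≡y (x≢0∧x*y≡0⇒y≡0 c₁-c₂≢0 [c₁-c₂]*[4g*[z-z̄]-8g*h]≡0))
                               (solve 2 (λ k h → num 2 :* k :* h := k :* (num 2 :* h)) refl 4g h)

      halfChord² : Carrier → Carrier → Carrier
      halfChord² c r = r + (h - c) * (h - c)

      on-circle⇔ : ∀ {c r z} → conj c ≡ - c → conj z ≡ z - 2# * h →
                   (B1 c r (just z) ⇔ (z - h) * (z - h) ≡ halfChord² c r)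
      on-circle⇔ {c} {r} {z} conj-c≡-c z-on-line =
        ≡.subst (λ t → (t ≡ r) ⇔ ((z - h) * (z - h) ≡ halfChord² c r)) (sym circle≡) x-y≡z⇔x≡z+y
        where
        circle≡ : (z - c) * (conj z - conj c) ≡ (z - h) * (z - h) - (h - c) * (h - c)
        circle≡ = trans (cong₂ (λ t u → (z - c) * (t - u)) z-on-line conj-c≡-c)
          (solve 3 (λ z h c → (z :- c) :* ((z :- num 2 :* h) :- :- c) := (z :- h) :* (z :- h) :- (h :- c) :* (h :- c)) refl z h c)

      halfChord²₁≡0⇔Δ≡0 : halfChord² c₁ r₁ ≡ 0# ⇔ Δ c₁ c₂ ≡ 0#
      halfChord²₁≡0⇔Δ≡0 = *-≡0⇔ (*-≢0 8g≢0 8g≢0) (*-≢0 σ≢0 σ≢0) ([8g]²*halfChord²≡σ²*Δ radius₁ 8g*h)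

      halfChord²₂≡0⇔Δ≡0 : halfChord² c₂ r₂ ≡ 0# ⇔ Δ c₁ c₂ ≡ 0#
      halfChord²₂≡0⇔Δ≡0 = *-≡0⇔ (*-≢0 8g≢0 8g≢0) (*-≢0 σ≢0 σ≢0)
        (trans ([8g]²*halfChord²≡σ²*Δ radius₂ (trans 8g*h (cong (_* (σ * σ)) (+-comm c₁ c₂)))) (cong (σ * σ *_) (Δ-sym c₂ c₁)))

      tangent⇒Δ≡0 : Tangent (B1 c₁ r₁) (B1 c₂ r₂) → Δ c₁ c₂ ≡ 0#
      tangent⇒Δ≡0 (_ , nothing , (() , _) , _)
      tangent⇒Δ≡0 (_ , just z , (on₁ , on₂) , unique) = Equivalence.to halfChord²₁≡0⇔Δ≡0 (begin
        halfChord² c₁ r₁         ≡⟨ sym (Equivalence.to (on-circle⇔ conj-c₁ z-on-line) on₁) ⟩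
        (z - h) * (z - h)     ≡⟨ cong (λ t → t * t) z-h≡0 ⟩
        0# * 0#               ≡⟨ zeroˡ 0# ⟩
        0#                    ∎)
        where
        open ≡-Reasoning
        z-on-line : conj z ≡ z - 2# * h
        z-on-line = radical-line on₁ on₂
        z* : Carrier
        z* = 2# * h - z

        z*-on-line : conj z* ≡ z* - 2# * h
        z*-on-line = begin
          conj (2# * h - z)              ≡⟨ trans (conj-- _ z) (cong₂ _-_ (trans (conj-* 2# h) (cong₂ _*_ conj-2 conj-h)) z-on-line) ⟩
          2# * - h - (z - 2# * h)
            ≡⟨ solve 2 (λ h z → num 2 :* :- h :- (z :- num 2 :* h) := (num 2 :* h :- z) :- num 2 :* h) refl h z ⟩
          (2# * h - z) - 2# * h          ∎

        z*-on : ∀ {c r} → conj c ≡ - c → B1 c r (just z) → B1 c r (just z*)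
        z*-on conj-c≡-c on = Equivalence.from (on-circle⇔ conj-c≡-c z*-on-line)
          (trans (solve 2 (λ h z → (num 2 :* h :- z :- h) :* (num 2 :* h :- z :- h) := (z :- h) :* (z :- h)) refl h z)
                 (Equivalence.to (on-circle⇔ conj-c≡-c z-on-line) on))

        z-h≡0 : z - h ≡ 0#
        z-h≡0 = x≡-x⇒x≡0 (begin
          z - h              ≡⟨ cong (_- h) (sym (Maybe.just-injective (unique (just z*) (z*-on conj-c₁ on₁) (z*-on conj-c₂ on₂)))) ⟩
          2# * h - z - h     ≡⟨ solve 2 (λ h z → num 2 :* h :- z :- h := :- (z :- h)) refl h z ⟩
          - (z - h)          ∎)

      Δ≡0⇒tangent : Distinct (B1 c₁ r₁) (B1 c₂ r₂) → Δ c₁ c₂ ≡ 0# → Tangent (B1 c₁ r₁) (B1 c₂ r₂)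
      Δ≡0⇒tangent distinct Δ≡0 = distinct , just h , (h-on conj-c₁ halfChord²₁≡0 , h-on conj-c₂ halfChord²₂≡0) , unique
        where
        halfChord²₁≡0 : halfChord² c₁ r₁ ≡ 0#
        halfChord²₁≡0 = Equivalence.from halfChord²₁≡0⇔Δ≡0 Δ≡0
        halfChord²₂≡0 : halfChord² c₂ r₂ ≡ 0#
        halfChord²₂≡0 = Equivalence.from halfChord²₂≡0⇔Δ≡0 Δ≡0

        h-on-line : conj h ≡ h - 2# * h
        h-on-line = trans conj-h (solve 1 (λ h → :- h := h :- num 2 :* h) refl h)

        h-on : ∀ {c r} → conj c ≡ - c → halfChord² c r ≡ 0# → B1 c r (just h)
        h-on conj-c≡-c halfChord²≡0 = Equivalence.from (on-circle⇔ conj-c≡-c h-on-line)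
          (trans (trans (cong (λ t → t * t) (-‿inverseʳ h)) (zeroˡ 0#)) (sym halfChord²≡0))

        unique : ∀ Q → B1 c₁ r₁ Q → B1 c₂ r₂ Q → Q ≡ just h
        unique (just z) on₁ on₂ = cong just (x-y≡0⇒x≡y (x*x≡0⇒x≡0
          (trans (Equivalence.to (on-circle⇔ conj-c₁ (radical-line on₁ on₂)) on₁) halfChord²₁≡0)))

      F₁ F₂ : Carrier → Carrier
      F₁ t = c₁ * (2# * t + δ) - c₂ * (2# * t - δ)
      F₂ t = c₂ * (2# * t + δ) - c₁ * (2# * t - δ)

      Δ≡F₁*F₂ : ∀ {t} → t * t ≡ - g → Δ c₁ c₂ ≡ F₁ t * F₂ t
      Δ≡F₁*F₂ {t} t²≡-g = begin
        (δ * (c₁ + c₂)) * (δ * (c₁ + c₂)) + 2# * 2# * g * ((c₁ - c₂) * (c₁ - c₂))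
          ≡⟨ cong (λ u → (δ * (c₁ + c₂)) * (δ * (c₁ + c₂)) + 2# * 2# * u * ((c₁ - c₂) * (c₁ - c₂))) g≡-t² ⟩
        (δ * (c₁ + c₂)) * (δ * (c₁ + c₂)) + 2# * 2# * - (t * t) * ((c₁ - c₂) * (c₁ - c₂))
          ≡⟨ solve 4 (λ d c e t → (d :* (c :+ e)) :* (d :* (c :+ e)) :+ num 2 :* num 2 :* :- (t :* t) :* ((c :- e) :* (c :- e))
                     := (c :* (num 2 :* t :+ d) :- e :* (num 2 :* t :- d)) :* (e :* (num 2 :* t :+ d) :- c :* (num 2 :* t :- d)))
                     refl δ c₁ c₂ t ⟩
        F₁ t * F₂ t
          ∎
        where
        open ≡-Reasoning
        g≡-t² : g ≡ - (t * t)
        g≡-t² = trans (sym (-‿involutive g)) (cong -_ (sym t²≡-g))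

      F₁-F₂≢0 : ∀ {t} → t ≢ 0# → F₁ t - F₂ t ≢ 0#
      F₁-F₂≢0 {t} t≢0 F₁-F₂≡0 = *-≢0 (*-≢0 (*-≢0 2≢0 2≢0) t≢0) c₁-c₂≢0
        (trans (solve 4 (λ c e d t → num 2 :* num 2 :* t :* (c :- e)
                             := (c :* (num 2 :* t :+ d) :- e :* (num 2 :* t :- d)) :- (e :* (num 2 :* t :+ d) :- c :* (num 2 :* t :- d)))
                        refl c₁ c₂ δ t) F₁-F₂≡0)

      conj-F₁ : ∀ {t} → conj t ≡ t → conj (F₁ t) ≡ F₂ t
      conj-F₁ {t} conj-t≡t = begin
        conj (c₁ * (2# * t + δ) - c₂ * (2# * t - δ))
          ≡⟨ trans (conj-- _ _) (cong₂ _-_ (trans (conj-* c₁ _) (cong (conj c₁ *_) (conj-+ _ δ)))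
                                           (trans (conj-* c₂ _) (cong (conj c₂ *_) (conj-- _ δ)))) ⟩
        conj c₁ * (conj (2# * t) + conj δ) - conj c₂ * (conj (2# * t) - conj δ)
          ≡⟨ cong₂ (λ u v → conj c₁ * (v + u) - conj c₂ * (v - u)) conj-δ (trans (conj-* 2# t) (cong₂ _*_ conj-2 conj-t≡t)) ⟩
        conj c₁ * (2# * t + - δ) - conj c₂ * (2# * t - - δ)
          ≡⟨ cong₂ (λ u v → u * (2# * t + - δ) - v * (2# * t - - δ)) conj-c₁ conj-c₂ ⟩
        - c₁ * (2# * t + - δ) - - c₂ * (2# * t - - δ)
          ≡⟨ solve 4 (λ c e d t → :- c :* (num 2 :* t :+ :- d) :- :- e :* (num 2 :* t :- :- d)
                               := e :* (num 2 :* t :+ d) :- c :* (num 2 :* t :- d)) refl c₁ c₂ δ t ⟩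
        F₂ t
          ∎
        where open ≡-Reasoning

      Δ≡0⇒non-square : Δ c₁ c₂ ≡ 0# → ¬ IsSquareInGFq (- g)
      Δ≡0⇒non-square Δ≡0 (y , conj-y≡y , y²≡-g) = F₁-F₂≢0 y≢0 (begin
        F₁ y - F₂ y    ≡⟨ cong₂ _-_ F₁y≡0 F₂y≡0 ⟩
        0# - 0#        ≡⟨ -‿inverseʳ 0# ⟩
        0#             ∎)
        where
        open ≡-Reasoning
        y≢0 : y ≢ 0#
        y≢0 y≡0 = g≢0 (-x≡0⇒x≡0 (trans (sym y²≡-g) (trans (cong (_* y) y≡0) (zeroˡ y))))
        F₁y*F₂y≡0 : F₁ y * F₂ y ≡ 0#
        F₁y*F₂y≡0 = trans (sym (Δ≡F₁*F₂ y²≡-g)) Δ≡0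
        F₁y≡0 : F₁ y ≡ 0#
        F₁y≡0 = Sum.[ id , (λ F₂y≡0 → conj≡0⇒≡0 (trans (conj-F₁ conj-y≡y) F₂y≡0)) ] (x*y≡0⇒x≡0⊎y≡0 F₁y*F₂y≡0)
        F₂y≡0 : F₂ y ≡ 0#
        F₂y≡0 = trans (sym (conj-F₁ conj-y≡y)) (trans (cong conj F₁y≡0) conj-0)

      module _ {s} (s²≡-g : s * s ≡ - g) where
        [2s-δ]*[2s+δ]≡-σ² : (2# * s - δ) * (2# * s + δ) ≡ - (σ * σ)
        [2s-δ]*[2s+δ]≡-σ² = begin
          (2# * s - δ) * (2# * s + δ)
            ≡⟨ solve 2 (λ s d → (num 2 :* s :- d) :* (num 2 :* s :+ d) := num 2 :* num 2 :* (s :* s) :- d :* d) refl s δ ⟩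
          2# * 2# * (s * s) - δ * δ
            ≡⟨ cong (λ t → 2# * 2# * t - δ * δ) s²≡-g ⟩
          2# * 2# * - g - δ * δ
            ≡⟨ solve 2 (λ a b → num 2 :* num 2 :* :- (a :* b) :- (a :- b) :* (a :- b) := :- ((a :+ b) :* (a :+ b))) refl γ γ̄ ⟩
          - (σ * σ)
            ∎
          where open ≡-Reasoning

        [2s-δ]*[2s+δ]≢0 : (2# * s - δ) * (2# * s + δ) ≢ 0#
        [2s-δ]*[2s+δ]≢0 eq = *-≢0 σ≢0 σ≢0 (-x≡0⇒x≡0 (trans (sym [2s-δ]*[2s+δ]≡-σ²) eq))

        2s-δ≢0 : 2# * s - δ ≢ 0#
        2s-δ≢0 2s-δ≡0 = [2s-δ]*[2s+δ]≢0 (trans (cong (_* (2# * s + δ)) 2s-δ≡0) (zeroˡ _))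

        2s+δ≢0 : 2# * s + δ ≢ 0#
        2s+δ≢0 2s+δ≡0 = [2s-δ]*[2s+δ]≢0 (trans (cong ((2# * s - δ) *_) 2s+δ≡0) (zeroʳ _))

        F₁≡0⇔ : F₁ s ≡ 0# ⇔ c₂ ≡ c₁ * ((2# * s + δ) / (2# * s - δ))
        F₁≡0⇔ = ⇔.trans x-y≡0⇔x≡y (⇔.trans (mk⇔ sym sym) (⇔.sym (*-/-≡⇔ 2s-δ≢0)))

        F₂≡0⇔ : F₂ s ≡ 0# ⇔ c₂ ≡ c₁ * ((2# * s - δ) / (2# * s + δ))
        F₂≡0⇔ = ⇔.trans x-y≡0⇔x≡y (⇔.sym (*-/-≡⇔ 2s+δ≢0))

        Δ≡0⇔alternative : Δ c₁ c₂ ≡ 0# ⇔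
          (c₂ ≡ c₁ * ((2# * s + δ) / (2# * s - δ)) ⊎ c₂ ≡ c₁ * ((2# * s - δ) / (2# * s + δ)))
        Δ≡0⇔alternative = ⇔.trans (≡.subst (λ t → (Δ c₁ c₂ ≡ 0#) ⇔ (t ≡ 0#)) (Δ≡F₁*F₂ s²≡-g) ⇔.refl)
                                  (⇔.trans x*y≡0⇔x≡0⊎y≡0 (F₁≡0⇔ ⊎-⇔ F₂≡0⇔))

        tangent⇔non-square×alternative : Distinct (B1 c₁ r₁) (B1 c₂ r₂) →
          Tangent (B1 c₁ r₁) (B1 c₂ r₂) ⇔
            (¬ IsSquareInGFq (- g) × (c₂ ≡ c₁ * ((2# * s + δ) / (2# * s - δ)) ⊎ c₂ ≡ c₁ * ((2# * s - δ) / (2# * s + δ))))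
        tangent⇔non-square×alternative distinct = mk⇔
          (λ tangent → Δ≡0⇒non-square (tangent⇒Δ≡0 tangent) , Equivalence.to Δ≡0⇔alternative (tangent⇒Δ≡0 tangent))
          (λ (_ , alternative) → Δ≡0⇒tangent distinct (Equivalence.from Δ≡0⇔alternative alternative))

open import Data.Nat using (ℕ; _^_; _≥_)
open import Data.Nat.Primality using (Prime)
open import Data.Product using (_×_)
open import Data.Sum using (_⊎_)
open import Relation.Nullary using (¬_)
open import Relation.Binary.PropositionalEquality using (_≡_)
open import Function.Bundles using (_⇔_)

lemma4p4 : (p m : ℕ) → Prime p → ¬ (p ≡ 2) → m ≥ 1 →
  (K : FiniteField ((p ^ m) ^ 2)) →
  let q = p ^ m
      open FiniteField K renaming (_^_ to _^ᴷ_)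
      open Plane q K
  in (γ : Carrier) → ¬ (γ ^ᴷ 2 ≡ conj γ ^ᴷ 2) →
     (c₁ r₁ c₂ r₂ : Carrier) →
     ValidB1 c₁ r₁ → ValidB1 c₂ r₂ →
     Distinct (B1 c₁ r₁) (B1 c₂ r₂) →
     Tangent (B1 c₁ r₁) (B2 γ 0#) → Tangent (B1 c₁ r₁) (B2 (conj γ) 0#) →
     Tangent (B1 c₂ r₂) (B2 γ 0#) → Tangent (B1 c₂ r₂) (B2 (conj γ) 0#) →
     c₁ ≡ - conj c₁ → c₂ ≡ - conj c₂ →
     (s : Carrier) → s * s ≡ - (γ * conj γ) →
     (Tangent (B1 c₁ r₁) (B1 c₂ r₂) ⇔
       (¬ IsSquareInGFq (- (γ * conj γ)) ×
        ((c₂ ≡ c₁ * ((2# * s + (γ - conj γ)) / (2# * s - (γ - conj γ))))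
         ⊎ (c₂ ≡ c₁ * ((2# * s - (γ - conj γ)) / (2# * s + (γ - conj γ)))))))
-- Tangency to B²(γ̄,0) is implied by tangency to B²(γ,0), since z ↦ −z̄ fixes a circle with
-- anti-fixed centre and swaps the two lines.
lemma4p4 p m p-prime p≢2 _ K γ γ²≢γ̄² c₁ r₁ c₂ r₂ _ _ distinct tangent₁ _ tangent₂ _ c₁≡-c̄₁ c₂≡-c̄₂ s s²≡-g =
  tangent⇔non-square×alternative s²≡-g distinct
  where
  open FiniteField K using (_*_; -_)
  open Plane (p ^ m) K using (conj)
  open Conjugation p m p-prime K
  open Geometry (p ^ m) K conj-isInvolutiveAutomorphism (2≢0 p≢2)
  open TangentCircles γ γ²≢γ̄²
  conj-c₁ : conj c₁ ≡ - c₁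
  conj-c₁ = anti-fixed c₁≡-c̄₁
  conj-c₂ : conj c₂ ≡ - c₂
  conj-c₂ = anti-fixed c₂≡-c̄₂
  radius₁ : 4g * r₁ ≡ (c₁ * δ) * (c₁ * δ)
  radius₁ = tangent-to-line⇒radius conj-c₁ tangent₁
  radius₂ : 4g * r₂ ≡ (c₂ * δ) * (c₂ * δ)
  radius₂ = tangent-to-line⇒radius conj-c₂ tangent₂
  open CircleTangency conj-c₁ conj-c₂ radius₁ radius₂ (distinct⇒c₁≢c₂ radius₁ radius₂ distinct)
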